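{- Let $T$ be a balanced tree with $\mathrm{height}(T)=2$. Then $T$ has two leaves at distance 4 from each other, and hence $T$ is not well-totally dominated.
   Context: All graphs are finite and simple. A leaf is a vertex of degree 1; the height of a vertex is its minimum distance to a leaf; $\mathrm{height}(T)$ is the maximum height of a vertex of $T$. A tree is balanced if no two vertices of the same height are adjacent. A total dominating set is a set $S$ of vertices with $N(S)=V$ ($N$ = union of open neighborhoods), and a graph is well-totally dominated if all its inclusion-minimal total dominating sets have the same size. -}

module Defs where

open import Data.Nat using (ℕ; zero; suc; _<_; _≤_)
open import Data.Fin using (Fin)
open import Data.Fin.Subset using (Subset; _∈_; _⊂_; ∣_∣)
open import Data.Vec using (Vec; lookup; head; last)
open import Data.Bool using (Bool; T)
open import Data.Product using (Σ; ∃; ∃-syntax; _×_)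
open import Data.Empty using (⊥)
open import Relation.Nullary using (¬_)
open import Relation.Binary.PropositionalEquality using (_≡_)
open import Function.Definitions using (Injective)

record Graph : Set where
  field
    n      : ℕ
    adj    : Fin n → Fin n → Bool
    sym    : ∀ u v → T (adj u v) → T (adj v u)
    irrefl : ∀ v → ¬ T (adj v v)

module _ (G : Graph) where
  open Graph G

  Adj : Fin n → Fin n → Set
  Adj u v = T (adj u v)

  data Walk : Fin n → Fin n → ℕ → Set where
    here : ∀ {v} → Walk v v 0
    step : ∀ {u w v k} → Adj u w → Walk w v k → Walk u v (suc k)

  Connected : Set
  Connected = ∀ u v → ∃[ k ] Walk u v k

  IsCycle : ∀ {m} → Vec (Fin n) (suc (suc (suc m))) → Set
  IsCycle {m} c =
    Injective _≡_ _≡_ (lookup c)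
    × (∀ (i : Fin (suc (suc m))) →
         Adj (lookup c (Data.Fin.inject₁ i)) (lookup c (Data.Fin.suc i)))
    × Adj (last c) (head c)

  Acyclic : Set
  Acyclic = ∀ m (c : Vec (Fin n) (suc (suc (suc m)))) → ¬ IsCycle c

  IsTree : Set
  IsTree = Connected × Acyclic

  Dist : Fin n → Fin n → ℕ → Set
  Dist u v d = Walk u v d × (∀ k → k < d → ¬ Walk u v k)

  IsLeaf : Fin n → Set
  IsLeaf v = ∃[ w ] (Adj v w × (∀ w' → Adj v w' → w' ≡ w))

  HasHeight : Fin n → ℕ → Set
  HasHeight v h =
    (∃[ l ] (IsLeaf l × Dist v l h))
    × (∀ l d → IsLeaf l → Dist v l d → h ≤ d)

  TreeHeight : ℕ → Set
  TreeHeight h = (∃[ v ] HasHeight v h) × (∀ v h' → HasHeight v h' → h' ≤ h)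

  Balanced : Set
  Balanced = ∀ u v h → Adj u v → HasHeight u h → HasHeight v h → ⊥

  IsTDS : Subset n → Set
  IsTDS S = ∀ v → ∃[ u ] (u ∈ S × Adj v u)

  IsMinimalTDS : Subset n → Set
  IsMinimalTDS S = IsTDS S × (∀ S' → S' ⊂ S → ¬ IsTDS S')

  WellTotallyDominated : Set
  WellTotallyDominated =
    ∀ S S' → IsMinimalTDS S → IsMinimalTDS S' → ∣ S ∣ ≡ ∣ S' ∣

{-# OPTIONS --safe #-}
-- Let v be a vertex of height 2. Each neighbour of v has height at most 2 (the
-- height of the tree), not 2 (balance) and not 0 (v is at distance at least 2
-- from every leaf), so it is a non-leaf support vertex; as v is not a leaf it has
-- two such neighbours u₁, u₂. Balance forbids adjacent vertices of height 1, so
-- u₁ and u₂ are non-adjacent and their leaves are at distance 4.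
-- Leaves and support vertices form a total dominating set. A minimal one D
-- inside it dominates u₁ and u₂ by leaves (again by balance), and replacing
-- these two leaves by v gives a smaller total dominating set, hence a smaller
-- minimal one.
module Submission where

open import Defs
open import Data.Product using (∃-syntax; _×_)
open import Relation.Nullary using (¬_)

open import Function using (_∘_; id)
open import Data.Bool using (T?)
open import Data.Bool.Properties using (T-≡)
open import Data.Empty using (⊥-elim)
open import Data.Fin using (Fin; _≟_)
open import Data.Fin.Properties using (any?; all?; ¬∀⟶∃¬)
open import Data.Fin.Subset using (Subset; _∈_; _⊆_; _∪_; _-_; ⁅_⁆; ∣_∣; inside; outside)
open import Data.Fin.Subset.Properties
  using (_∈?_; ∪-identityʳ; x∈p∪q⁺; x∈⁅x⁆; x∈p∧x≢y⇒x∈p-y; x∈p⇒p-x⊂p; x∈p⇒∣p-x∣<∣p∣; p⊆q⇒∣p∣≤∣q∣)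
open import Data.Nat using (ℕ; zero; suc; _≤_; _<_; z≤n; s≤s)
open import Data.Nat.Properties
  using (≤-refl; ≤-trans; ≤-<-trans; <-≤-trans; ≤-pred; n≤1+n; n<1+n; ≮⇒≥; n≤0⇒n≡0; <⇒≢)
open import Data.Product using (_,_; proj₁; proj₂)
open import Data.Sum using (_⊎_; inj₁; inj₂)
open import Data.Vec using (_∷_; tabulate)
open import Data.Vec.Properties using (lookup∘tabulate; []=⇒lookup; lookup⇒[]=)
open import Function.Bundles using (Equivalence)
open import Relation.Nullary using (Dec; yes; no)
open import Relation.Nullary.Decidable
  using (⌊_⌋; map′; toWitness; fromWitness; _×-dec_; _⊎-dec_; _→-dec_)
open import Relation.Unary using (Pred; Decidable)
open import Relation.Binary.PropositionalEquality
  using (_≡_; _≢_; refl; sym; trans; subst; subst₂; ≢-sym)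

least-witness : ∀ {ℓ} {P : Pred ℕ ℓ} → Decidable P → ∀ {k} → P k →
                ∃[ d ] (P d × (∀ {d'} → d' < d → ¬ P d'))
least-witness P? {k} pk with P? 0
... | yes p0 = 0 , p0 , λ ()
least-witness P? {zero} pk | no ¬p0 = ⊥-elim (¬p0 pk)
least-witness P? {suc k} pk | no ¬p0 with least-witness (P? ∘ suc) pk
... | d , pd , below = suc d , pd , λ { {zero} _ → ¬p0 ; {suc _} (s≤s d'<d) → below d'<d }

subsetOf : ∀ {n ℓ} {P : Pred (Fin n) ℓ} → Decidable P → Subset n
subsetOf P? = tabulate (λ x → ⌊ P? x ⌋)

module _ {n ℓ} {P : Pred (Fin n) ℓ} (P? : Decidable P) {x : Fin n} where

  ∈-subsetOf⁺ : P x → x ∈ subsetOf P?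
  ∈-subsetOf⁺ px =
    lookup⇒[]= x _ (trans (lookup∘tabulate _ x) (Equivalence.to T-≡ (fromWitness {a? = P? x} px)))

  ∈-subsetOf⁻ : x ∈ subsetOf P? → P x
  ∈-subsetOf⁻ x∈ =
    toWitness {a? = P? x} (Equivalence.from T-≡ (trans (sym (lookup∘tabulate _ x)) ([]=⇒lookup x∈)))

∣p∪⁅x⁆∣≤1+∣p∣ : ∀ {n} (p : Subset n) x → ∣ p ∪ ⁅ x ⁆ ∣ ≤ suc ∣ p ∣
∣p∪⁅x⁆∣≤1+∣p∣ (inside ∷ p)  Fin.zero    rewrite ∪-identityʳ p = n≤1+n _
∣p∪⁅x⁆∣≤1+∣p∣ (outside ∷ p) Fin.zero    rewrite ∪-identityʳ p = ≤-refl
∣p∪⁅x⁆∣≤1+∣p∣ (inside ∷ p)  (Fin.suc x) = s≤s (∣p∪⁅x⁆∣≤1+∣p∣ p x)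
∣p∪⁅x⁆∣≤1+∣p∣ (outside ∷ p) (Fin.suc x) = ∣p∪⁅x⁆∣≤1+∣p∣ p x

∣p-x-y∪⁅z⁆∣<∣p∣ : ∀ {n} {p : Subset n} {x y} z → x ∈ p → y ∈ p → x ≢ y →
                  ∣ (p - x - y) ∪ ⁅ z ⁆ ∣ < ∣ p ∣
∣p-x-y∪⁅z⁆∣<∣p∣ {p = p} {x} {y} z x∈p y∈p x≢y =
  ≤-<-trans (≤-trans (∣p∪⁅x⁆∣≤1+∣p∣ (p - x - y) z)
                     (x∈p⇒∣p-x∣<∣p∣ (x∈p∧x≢y⇒x∈p-y y∈p (≢-sym x≢y))))
            (x∈p⇒∣p-x∣<∣p∣ x∈p)

module _ (G : Graph) where
  open Graph G using (n; adj; irrefl)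

  private variable
    d d₁ d₂ l l₁ l₂ s t u u₁ u₂ v w x y z : Fin n
    h : ℕ
    D D' : Subset n

  adj-sym : Adj G u v → Adj G v u
  adj-sym = Graph.sym G _ _

  IsSupport : Fin n → Set
  IsSupport s = ∃[ l ] (IsLeaf G l × Adj G s l)

  LeafOrSupport : Fin n → Set
  LeafOrSupport z = IsLeaf G z ⊎ IsSupport z

  adj? : ∀ u v → Dec (Adj G u v)
  adj? u v = T? (adj u v)

  leaf? : ∀ v → Dec (IsLeaf G v)
  leaf? v = any? λ w → adj? v w ×-dec all? λ w' → adj? v w' →-dec w' ≟ w

  leafOrSupport? : ∀ z → Dec (LeafOrSupport z)
  leafOrSupport? z = leaf? z ⊎-dec any? λ l → leaf? l ×-dec adj? z l

  walk? : ∀ k u v → Dec (Walk G u v k)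
  walk? zero    u v = map′ (λ { refl → here }) (λ { here → refl }) (u ≟ v)
  walk? (suc k) u v = map′ (λ (w , uw , p) → step uw p) (λ { (step uw p) → _ , uw , p })
                           (any? λ w → adj? u w ×-dec walk? k w v)

  tds? : ∀ D → Dec (IsTDS G D)
  tds? D = all? λ z → any? λ u → (u ∈? D) ×-dec adj? z u

  walk-0⇒≡ : Walk G u v 0 → u ≡ v
  walk-0⇒≡ here = refl

  leaf-neighbour-unique : IsLeaf G l → Adj G l x → Adj G l y → x ≡ y
  leaf-neighbour-unique (_ , _ , unique) lx ly = trans (unique _ lx) (sym (unique _ ly))

  another-neighbour : ¬ IsLeaf G v → Adj G v u → ∃[ w ] (Adj G v w × w ≢ u)
  another-neighbour {v = v} {u = u} nonleaf vu
    with ¬∀⟶∃¬ n (λ w → Adj G v w → w ≡ u) (λ w → adj? v w →-dec w ≟ u)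
               (λ unique → nonleaf (u , vu , unique))
  ... | w , ¬[vw⇒w≡u] with adj? v w
  ...   | yes vw = w , vw , λ w≡u → ¬[vw⇒w≡u] λ _ → w≡u
  ...   | no ¬vw = ⊥-elim (¬[vw⇒w≡u] λ vw → ⊥-elim (¬vw vw))

  adj⇒dist-1 : Adj G u v → Dist G u v 1
  adj⇒dist-1 {u = u} uv = step uv here , λ
    { zero    _          w → irrefl u (subst (Adj G u) (sym (walk-0⇒≡ w)) uv)
    ; (suc _) (s≤s ()) _ }

  leaves-at-distance-4 : IsLeaf G l₁ → IsLeaf G l₂ → Adj G u₁ l₁ → Adj G u₂ l₂ →
                         Adj G u₁ v → Adj G v u₂ → u₁ ≢ u₂ → ¬ Adj G u₁ u₂ → Dist G l₁ l₂ 4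
  leaves-at-distance-4 {l₁ = l₁} {l₂ = l₂} {u₁ = u₁} {u₂ = u₂}
                       leaf₁ leaf₂ u₁l₁ u₂l₂ u₁v vu₂ u₁≢u₂ ¬u₁u₂ =
    step (adj-sym u₁l₁) (step u₁v (step vu₂ (step u₂l₂ here))) , no-shorter
    where
    from-l₁ : Adj G l₁ x → x ≡ u₁
    from-l₁ l₁x = leaf-neighbour-unique leaf₁ l₁x (adj-sym u₁l₁)

    to-l₂ : Adj G x l₂ → x ≡ u₂
    to-l₂ xl₂ = leaf-neighbour-unique leaf₂ (adj-sym xl₂) (adj-sym u₂l₂)

    no-shorter : ∀ k → k < 4 → ¬ Walk G l₁ l₂ k
    no-shorter 0 _ w = u₁≢u₂ (to-l₂ (subst (Adj G u₁) (walk-0⇒≡ w) u₁l₁))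
    no-shorter 1 _ (step l₁l₂ here) =
      ¬u₁u₂ (subst (λ y → Adj G y u₂) (from-l₁ l₁l₂) (adj-sym u₂l₂))
    no-shorter 2 _ (step l₁x (step xl₂ here)) =
      u₁≢u₂ (trans (sym (from-l₁ l₁x)) (to-l₂ xl₂))
    no-shorter 3 _ (step l₁x (step xy (step yl₂ here))) =
      ¬u₁u₂ (subst₂ (Adj G) (from-l₁ l₁x) (to-l₂ yl₂) xy)
    no-shorter (suc (suc (suc (suc _)))) (s≤s (s≤s (s≤s (s≤s ())))) _

  height-exists : Connected G → IsLeaf G l → ∀ z → ∃[ h ] HasHeight G z h
  height-exists connected leaf z
    with least-witness (λ d → any? λ l → leaf? l ×-dec walk? d z l)
                       (_ , leaf , proj₂ (connected z _))
  ... | h , (l , leaf-l , zl) , shorter =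
    h , (l , leaf-l , zl , λ _ k<h w → shorter k<h (l , leaf-l , w))
      , λ l' d leaf' (w , _) → ≮⇒≥ λ d<h → shorter d<h (l' , leaf' , w)

  height-0⇒leaf : HasHeight G z 0 → IsLeaf G z
  height-0⇒leaf ((_ , leaf , here , _) , _) = leaf

  height-1⇒support : HasHeight G z 1 → IsSupport z
  height-1⇒support ((l , leaf , step zl here , _) , _) = l , leaf , zl

  height-2⇒adj-support : HasHeight G z 2 → ∃[ y ] (Adj G z y × IsSupport y)
  height-2⇒adj-support ((l , leaf , step zy (step yl here) , _) , _) = _ , zy , l , leaf , yl

  leaf⇒height-0 : IsLeaf G z → HasHeight G z h → h ≡ 0
  leaf⇒height-0 {z = z} leaf (_ , minimal) = n≤0⇒n≡0 (minimal z 0 leaf (here , λ _ ()))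

  adj-leaf⇒height≤1 : HasHeight G z h → Adj G z l → IsLeaf G l → h ≤ 1
  adj-leaf⇒height≤1 {l = l} (_ , minimal) zl leaf = minimal l 1 leaf (adj⇒dist-1 zl)

  support⇒height-1 : IsSupport s → ¬ IsLeaf G s → HasHeight G s 1
  support⇒height-1 (l , leaf , sl) nonleaf = (l , leaf , adj⇒dist-1 sl) , λ
    { _ zero    leaf' (w , _) → ⊥-elim (nonleaf (subst (IsLeaf G) (sym (walk-0⇒≡ w)) leaf'))
    ; _ (suc _) _     _       → s≤s z≤n }

  nonleaf-supports-nonadjacent : Balanced G → IsSupport s → ¬ IsLeaf G s →
                                 IsSupport t → ¬ IsLeaf G t → ¬ Adj G s t
  nonleaf-supports-nonadjacent balanced support-s nonleaf-s support-t nonleaf-t st =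
    balanced _ _ 1 st (support⇒height-1 support-s nonleaf-s) (support⇒height-1 support-t nonleaf-t)

  adj-nonleaf-support⇒leaf : Balanced G → IsSupport u → ¬ IsLeaf G u → Adj G u d →
                             LeafOrSupport d → IsLeaf G d
  adj-nonleaf-support⇒leaf _ _ _ _ (inj₁ leaf) = leaf
  adj-nonleaf-support⇒leaf {d = d} balanced support-u nonleaf-u ud (inj₂ support-d) with leaf? d
  ... | yes leaf    = leaf
  ... | no  nonleaf =
    ⊥-elim (nonleaf-supports-nonadjacent balanced support-u nonleaf-u support-d nonleaf ud)

  tds-mono : D ⊆ D' → IsTDS G D → IsTDS G D'
  tds-mono D⊆D' tds z with tds z
  ... | u , u∈D , zu = u , D⊆D' u∈D , zu

  irredundant⇒minimal : IsTDS G D → (∀ {x} → x ∈ D → ¬ IsTDS G (D - x)) → IsMinimalTDS G D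
  irredundant⇒minimal tds irredundant = tds , λ
    { S (S⊆D , x , x∈D , x∉S) tds-S →
        irredundant x∈D (tds-mono (λ y∈S → x∈p∧x≢y⇒x∈p-y (S⊆D y∈S) λ { refl → x∉S y∈S }) tds-S) }

  minimal-tds-⊆ : IsTDS G D → ∃[ D' ] (D' ⊆ D × IsMinimalTDS G D')
  minimal-tds-⊆ {D = D} = shrink D (n<1+n ∣ D ∣)
    where
    shrink : ∀ {k} D → ∣ D ∣ < k → IsTDS G D → ∃[ D' ] (D' ⊆ D × IsMinimalTDS G D')
    shrink {suc k} D ∣D∣≤k tds with any? (λ x → (x ∈? D) ×-dec tds? (D - x))
    ... | no irredundant =
      D , id , irredundant⇒minimal tds λ x∈D tds' → irredundant (_ , x∈D , tds')
    ... | yes (x , x∈D , tds')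
      with shrink (D - x) (<-≤-trans (x∈p⇒∣p-x∣<∣p∣ x∈D) (≤-pred ∣D∣≤k)) tds'
    ...   | D' , D'⊆D-x , minimal = D' , proj₁ (x∈p⇒p-x⊂p x∈D) ∘ D'⊆D-x , minimal

  smaller-tds⇒¬well-totally-dominated : IsMinimalTDS G D → IsTDS G D' → ∣ D' ∣ < ∣ D ∣ →
                                       ¬ WellTotallyDominated G
  smaller-tds⇒¬well-totally-dominated {D = D} minimal tds' ∣D'∣<∣D∣ wtd with minimal-tds-⊆ tds'
  ... | D'' , D''⊆D' , minimal'' =
    <⇒≢ (≤-<-trans (p⊆q⇒∣p∣≤∣q∣ D''⊆D') ∣D'∣<∣D∣) (sym (wtd D D'' minimal minimal''))

  adj-leaf⇒adj : IsLeaf G d → Adj G u d → Adj G u v → Adj G z d → Adj G z v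
  adj-leaf⇒adj {v = v} leaf ud uv zd =
    subst (λ y → Adj G y v) (leaf-neighbour-unique leaf (adj-sym ud) (adj-sym zd)) uv

  leaves-replaced-tds : IsTDS G D → IsLeaf G d₁ → IsLeaf G d₂ → Adj G u₁ d₁ → Adj G u₂ d₂ →
                        Adj G u₁ v → Adj G u₂ v → IsTDS G ((D - d₁ - d₂) ∪ ⁅ v ⁆)
  leaves-replaced-tds {d₁ = d₁} {d₂ = d₂} {v = v} tds leaf₁ leaf₂ u₁d₁ u₂d₂ u₁v u₂v z
    with tds z
  ... | d , d∈D , zd with d ≟ d₁ | d ≟ d₂
  ...   | yes refl | _        = v , x∈p∪q⁺ (inj₂ (x∈⁅x⁆ v)) , adj-leaf⇒adj leaf₁ u₁d₁ u₁v zd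
  ...   | no _     | yes refl = v , x∈p∪q⁺ (inj₂ (x∈⁅x⁆ v)) , adj-leaf⇒adj leaf₂ u₂d₂ u₂v zd
  ...   | no d≢d₁  | no d≢d₂  =
    d , x∈p∪q⁺ (inj₁ (x∈p∧x≢y⇒x∈p-y (x∈p∧x≢y⇒x∈p-y d∈D d≢d₁) d≢d₂)) , zd

  leavesAndSupports : Subset n
  leavesAndSupports = subsetOf leafOrSupport?

module BalancedHeightTwo (G : Graph) (connected : Connected G) (balanced : Balanced G)
                         (height≤2 : ∀ z h → HasHeight G z h → h ≤ 2)
                         {v} (height-v : HasHeight G v 2) where

  height-of : ∀ z → ∃[ h ] HasHeight G z h
  height-of with proj₁ height-v
  ... | _ , leaf , _ = height-exists G connected leaf

  leaf⊎support⊎height-2 : ∀ z → IsLeaf G z ⊎ IsSupport G z ⊎ HasHeight G z 2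
  leaf⊎support⊎height-2 z with height-of z
  ... | h , height-z with height≤2 z h height-z
  ...   | z≤n           = inj₁ (height-0⇒leaf G height-z)
  ...   | s≤s z≤n       = inj₂ (inj₁ (height-1⇒support G height-z))
  ...   | s≤s (s≤s z≤n) = inj₂ (inj₂ height-z)

  v-nonleaf : ¬ IsLeaf G v
  v-nonleaf leaf with leaf⇒height-0 G leaf height-v
  ... | ()

  neighbour⇒nonleaf : ∀ {u} → Adj G v u → ¬ IsLeaf G u
  neighbour⇒nonleaf vu leaf with adj-leaf⇒height≤1 G height-v vu leaf
  ... | s≤s ()

  neighbour⇒nonleaf-support : ∀ {u} → Adj G v u → IsSupport G u × ¬ IsLeaf G u
  neighbour⇒nonleaf-support {u} vu with leaf⊎support⊎height-2 u
  ... | inj₁ leaf            = ⊥-elim (neighbour⇒nonleaf vu leaf)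
  ... | inj₂ (inj₁ support)  = support , neighbour⇒nonleaf vu
  ... | inj₂ (inj₂ height-u) = ⊥-elim (balanced _ _ 2 vu height-v height-u)

  two-neighbours : ∃[ u₁ ] ∃[ u₂ ] (Adj G v u₁ × Adj G v u₂ × u₁ ≢ u₂)
  two-neighbours with proj₁ height-v
  ... | _ , _ , step vu₁ _ , _ with another-neighbour G v-nonleaf vu₁
  ...   | u₂ , vu₂ , u₂≢u₁ = _ , u₂ , vu₁ , vu₂ , ≢-sym u₂≢u₁

  leavesAndSupports-tds : IsTDS G (leavesAndSupports G)
  leavesAndSupports-tds z with leaf⊎support⊎height-2 z
  ... | inj₁ leaf@(u , zu , _)      = u , ∈-subsetOf⁺ _ (inj₂ (z , leaf , adj-sym G zu)) , zu
  ... | inj₂ (inj₁ (l , leaf , zl)) = l , ∈-subsetOf⁺ _ (inj₁ leaf) , zl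
  ... | inj₂ (inj₂ height-z) with height-2⇒adj-support G height-z
  ...   | y , zy , support          = y , ∈-subsetOf⁺ _ (inj₂ support) , zy

  module _ {u₁ u₂} (vu₁ : Adj G v u₁) (vu₂ : Adj G v u₂) (u₁≢u₂ : u₁ ≢ u₂) where

    two-leaves-at-distance-4 : ∃[ l₁ ] ∃[ l₂ ] (IsLeaf G l₁ × IsLeaf G l₂ × Dist G l₁ l₂ 4)
    two-leaves-at-distance-4
      with neighbour⇒nonleaf-support vu₁ | neighbour⇒nonleaf-support vu₂
    ... | s₁@(l₁ , leaf₁ , u₁l₁) , nonleaf₁ | s₂@(l₂ , leaf₂ , u₂l₂) , nonleaf₂ =
      l₁ , l₂ , leaf₁ , leaf₂ ,
      leaves-at-distance-4 G leaf₁ leaf₂ u₁l₁ u₂l₂ (adj-sym G vu₁) vu₂ u₁≢u₂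
        (nonleaf-supports-nonadjacent G balanced s₁ nonleaf₁ s₂ nonleaf₂)

    ¬well-totally-dominated : ¬ WellTotallyDominated G
    ¬well-totally-dominated with minimal-tds-⊆ G leavesAndSupports-tds
    ... | D , D⊆leavesAndSupports , minimal@(tds , _) with tds u₁ | tds u₂
    ...   | d₁ , d₁∈D , u₁d₁ | d₂ , d₂∈D , u₂d₂ =
      smaller-tds⇒¬well-totally-dominated G minimal
        (leaves-replaced-tds G tds leaf₁ leaf₂ u₁d₁ u₂d₂ (adj-sym G vu₁) (adj-sym G vu₂))
        (∣p-x-y∪⁅z⁆∣<∣p∣ v d₁∈D d₂∈D d₁≢d₂)
      where
      dominating-leaf : ∀ {u d} → Adj G v u → d ∈ D → Adj G u d → IsLeaf G d
      dominating-leaf vu d∈D ud =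
        let support , nonleaf = neighbour⇒nonleaf-support vu
        in adj-nonleaf-support⇒leaf G balanced support nonleaf ud
             (∈-subsetOf⁻ _ (D⊆leavesAndSupports d∈D))

      leaf₁ : IsLeaf G d₁
      leaf₁ = dominating-leaf vu₁ d₁∈D u₁d₁

      leaf₂ : IsLeaf G d₂
      leaf₂ = dominating-leaf vu₂ d₂∈D u₂d₂

      d₁≢d₂ : d₁ ≢ d₂
      d₁≢d₂ refl = u₁≢u₂ (leaf-neighbour-unique G leaf₁ (adj-sym G u₁d₁) (adj-sym G u₂d₂))

theorem4p10 : (G : Graph) → IsTree G → Balanced G → TreeHeight G 2 →
    (∃[ u ] ∃[ v ] (IsLeaf G u × IsLeaf G v × Dist G u v 4))
    × ¬ WellTotallyDominated G
theorem4p10 G (connected , _) balanced ((_ , height-v) , height≤2) =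
  let open BalancedHeightTwo G connected balanced height≤2 height-v
      (_ , _ , vu₁ , vu₂ , u₁≢u₂) = two-neighbours
  in two-leaves-at-distance-4 vu₁ vu₂ u₁≢u₂ , ¬well-totally-dominated vu₁ vu₂ u₁≢u₂
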